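{- Let $\ell$ be a positive integer. For all integers $n\geq 0$ and all integers $r$ with $\ell\nmid r$, $\overline{R_\ell^\ast}(\ell n+r)\equiv 0 \pmod{2}$.
   Context: An overpartition of $n$ is a partition of $n$ in which the first occurrence of each part size may optionally be overlined. For a positive integer $\ell$, $\overline{R_\ell^\ast}(n)$ denotes the number of overpartitions of $n$ in which no non-overlined part is divisible by $\ell$ (and $\overline{R_\ell^\ast}(m)=0$ for negative integers $m$). Equivalently, with $f_k:=\prod_{i\geq 1}(1-q^{ki})$, one has $\sum_{n\geq 0}\overline{R_\ell^\ast}(n)q^n = \frac{f_2 f_\ell}{f_1^2}$. -}

module Defs where

open import Data.Nat using (ℕ; zero; suc; _+_; _*_; _∸_; _≤?_)
open import Data.Nat.Divisibility using (_∣_; _∣?_)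
open import Data.Sum using (_⊎_)
open import Relation.Binary.PropositionalEquality using (_≡_)
open import Data.Bool using (Bool; true; false)
open import Data.List using (List; _∷_; []; length; filter; upTo; map)
open import Data.Nat.ListAction using (sum)
open import Data.Integer using (ℤ; +_; -[1+_])
open import Relation.Nullary using (Dec; yes; no; ¬_)
open import Relation.Nullary.Decidable using (_⊎-dec_; ¬?)
open import Data.Nat.Properties using (_≟_)

-- An overpartition is recorded by its multiplicity data: for each part size k,
-- a multiplicity c ≥ 0 and, when c ≥ 1, a flag b telling whether the first
-- occurrence of k is overlined.

nonOverlined : ℕ → Bool → ℕ
nonOverlined c true  = c ∸ 1
nonOverlined c false = c

-- Condition "no non-overlined part is divisible by ℓ" restricted to part size k:
-- either there are no non-overlined copies of k, or ℓ ∤ k.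
validFlag : (ℓ k c : ℕ) → Bool → Set
validFlag ℓ k c b = (nonOverlined c b ≡ 0) ⊎ ¬ (ℓ ∣ k)

validFlag? : (ℓ k c : ℕ) (b : Bool) → Dec (validFlag ℓ k c b)
validFlag? ℓ k c b = (nonOverlined c b ≟ 0) ⊎-dec ¬? (ℓ ∣? k)

choices : (ℓ k c : ℕ) → ℕ
choices ℓ k zero    = 1
choices ℓ k (suc c) = length (filter (validFlag? ℓ k (suc c)) (true ∷ false ∷ []))

-- OP ℓ k m = number of overpartitions of m, all parts ≤ k, in which no
-- non-overlined part is divisible by ℓ.
OP : (ℓ k m : ℕ) → ℕ
OP ℓ zero zero    = 1
OP ℓ zero (suc m) = 0
OP ℓ (suc k) m = sum (map term (upTo (suc m)))
  where
  term : ℕ → ℕ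
  term c with c * suc k ≤? m
  ... | yes _ = choices ℓ (suc k) c * OP ℓ k (m ∸ c * suc k)
  ... | no  _ = 0

-- \overline{R_ℓ^*}(n) for n : ℕ (all parts of an overpartition of n are ≤ n)
Rbar : (ℓ n : ℕ) → ℕ
Rbar ℓ n = OP ℓ n n

Rbarℤ : ℕ → ℤ → ℕ
Rbarℤ ℓ (+ n)     = Rbar ℓ n
Rbarℤ ℓ -[1+ n ]  = 0

module Submission where

open import Defs
open import Data.Nat using (ℕ; NonZero; zero; suc; _≤?_; _∸_) renaming (_*_ to _*ℕ_)
open import Data.Nat.Divisibility using (_∣?_; _∣0; ∣-refl; ∣m∣n⇒∣m+n; ∣n⇒∣m*n; ∣m⇒∣m*n; ∣m∸n∣n⇒∣m)
  renaming (_∣_ to _∣ℕ_)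
open import Data.Integer using (ℤ; +_; -[1+_]; _+_; _*_)
open import Data.Integer.Divisibility using (_∣_)
import Data.Integer.Divisibility.Signed as Signed
open import Data.List using ([]; _∷_; map; upTo)
open import Data.List.Properties using (map-cong)
open import Data.Nat.ListAction using (sum)
open import Data.Sum using (_⊎_; inj₁; inj₂)
open import Data.Empty using (⊥-elim)
open import Relation.Nullary using (¬_; yes; no)
open import Relation.Binary.PropositionalEquality using (_≡_; refl; cong; subst; sym)

-- Part sizes not divisible by ℓ come with two overline choices, so only
-- overpartitions whose parts are all divisible by ℓ, each non-overlined at most
-- once, can contribute an odd count.  Inductively on the largest part size k:
-- in OP ℓ k m the summand for multiplicity c has an even number of choices
-- unless ℓ ∣ c k, and then ℓ ∤ m − c k lets the induction hypothesis apply.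

∣-sum-map : ∀ {d} {f : ℕ → ℕ} → (∀ x → d ∣ℕ f x) → ∀ xs → d ∣ℕ sum (map f xs)
∣-sum-map d∣f []       = _ ∣0
∣-sum-map d∣f (x ∷ xs) = ∣m∣n⇒∣m+n (d∣f x) (∣-sum-map d∣f xs)

choices-even⊎∣ : ∀ ℓ k c → 2 ∣ℕ choices ℓ k c ⊎ ℓ ∣ℕ c *ℕ k
choices-even⊎∣ ℓ k zero = inj₂ (ℓ ∣0)
choices-even⊎∣ ℓ k 1 with ℓ ∣? k
... | no  _   = inj₁ ∣-refl
... | yes ℓ∣k = inj₂ (∣n⇒∣m*n 1 ℓ∣k)
choices-even⊎∣ ℓ k (suc (suc c)) with ℓ ∣? k
... | no  _ = inj₁ ∣-refl
... | yes _ = inj₁ (2 ∣0)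

OP-summand : (ℓ k m c : ℕ) → ℕ
OP-summand ℓ k m c with c *ℕ suc k ≤? m
... | yes _ = choices ℓ (suc k) c *ℕ OP ℓ k (m ∸ c *ℕ suc k)
... | no  _ = 0

mutual
  OP-suc : ∀ ℓ k m → OP ℓ (suc k) m ≡ sum (map (OP-summand ℓ k m) (upTo (suc m)))
  OP-suc ℓ k m = cong sum (map-cong (term≗OP-summand ℓ k m) (upTo (suc m)))

  -- The left-hand side is the unnamed local summand of OP in Defs; the mutual
  -- block lets Agda infer it from its use in OP-suc.
  term≗OP-summand : ∀ ℓ k m c → _ ≡ OP-summand ℓ k m c
  term≗OP-summand ℓ k m c with c *ℕ suc k ≤? m
  ... | yes _ = refl
  ... | no  _ = refl

OP-summand-even : ∀ ℓ k m → ¬ ℓ ∣ℕ m → (∀ m′ → ¬ ℓ ∣ℕ m′ → 2 ∣ℕ OP ℓ k m′) →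
                  ∀ c → 2 ∣ℕ OP-summand ℓ k m c
OP-summand-even ℓ k m ℓ∤m OP-even c with c *ℕ suc k ≤? m
... | no  _    = 2 ∣0
... | yes ck≤m with choices-even⊎∣ ℓ (suc k) c
...   | inj₁ 2∣choices = ∣m⇒∣m*n _ 2∣choices
...   | inj₂ ℓ∣ck      = ∣n⇒∣m*n (choices ℓ (suc k) c)
    (OP-even _ λ ℓ∣m∸ck → ℓ∤m (∣m∸n∣n⇒∣m ℓ ck≤m ℓ∣m∸ck ℓ∣ck))

OP-even : ∀ ℓ k m → ¬ ℓ ∣ℕ m → 2 ∣ℕ OP ℓ k m
OP-even ℓ zero    zero    ℓ∤0 = ⊥-elim (ℓ∤0 (ℓ ∣0))
OP-even ℓ zero    (suc m) _   = 2 ∣0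
OP-even ℓ (suc k) m       ℓ∤m = subst (2 ∣ℕ_) (sym (OP-suc ℓ k m))
  (∣-sum-map (OP-summand-even ℓ k m ℓ∤m (OP-even ℓ k)) (upTo (suc m)))

Rbar-even : ∀ ℓ n → ¬ ℓ ∣ℕ n → 2 ∣ℕ Rbar ℓ n
Rbar-even ℓ n = OP-even ℓ n n

∤⇒∤*+ : ∀ {d r : ℤ} m → ¬ d ∣ r → ¬ d ∣ d * m + r
∤⇒∤*+ {d} {r} m d∤r d∣dm+r = d∤r (Signed.∣⇒∣ᵤ
  (Signed.∣m+n∣m⇒∣n (Signed.∣ᵤ⇒∣ {d} {d * m + r} d∣dm+r) (Signed.∣m⇒∣m*n m Signed.∣-refl)))

theorem1p4 : (ℓ : ℕ) → .{{_ : NonZero ℓ}} → (n : ℕ) → (r : ℤ) → ¬ ((+ ℓ) ∣ r) →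
    2 ∣ℕ Rbarℤ ℓ ((+ ℓ) * (+ n) + r)
theorem1p4 ℓ n r ℓ∤r with (+ ℓ) * (+ n) + r | ∤⇒∤*+ {+ ℓ} {r} (+ n) ℓ∤r
... | + m      | ℓ∤m = Rbar-even ℓ m ℓ∤m
... | -[1+ _ ] | _   = 2 ∣0
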